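{- For every positive integer $k$, \[ \sum_{j=1}^k \gcd(j,k)\, c_k(j) = (\varphi(k))^2,\qquad \sum_{j=1}^k \tau(\gcd(j,k))\, c_k(j) = \varphi(k),\qquad \sum_{j=1}^k \sigma(\gcd(j,k))\, c_k(j) = k\,\varphi(k). \]
   Context: For $k\in\mathbb{N}$ and $j\in\mathbb{Z}$, $c_k(j)=\sum_{1\le m\le k,\ \gcd(m,k)=1}\exp(2\pi i m j/k)$ is the Ramanujan sum. $\varphi$ is Euler's totient function, $\tau(n)$ is the number of positive divisors of $n$, and $\sigma(n)$ is the sum of the positive divisors of $n$. -}

module Defs where

open import Level using (Level)
open import Data.Nat using (ℕ; zero; suc; _<_)
import Data.Nat as N
open import Data.Nat.GCD using (gcd)
open import Data.Nat.Divisibility using (_∣?_)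
open import Data.List using (List; filter; length; upTo; map)
import Data.List as L
open import Data.Nat.ListAction using (sum)
open import Data.Empty using (⊥)
open import Data.Sum using (_⊎_)
open import Relation.Nullary using (¬_; Dec; yes; no)
open import Algebra.Bundles using (CommutativeRing)

oneTo : ℕ → List ℕ
oneTo n = L.map suc (upTo n)

φ : ℕ → ℕ
φ k = length (filter (λ m → gcd m k N.≟ 1) (oneTo k))

divisors : ℕ → List ℕ
divisors n = filter (λ d → d ∣? n) (oneTo n)

τ : ℕ → ℕ
τ n = length (divisors n)

σ : ℕ → ℕ
σ n = sum (divisors n)

module _ {c ℓ : Level} (R : CommutativeRing c ℓ) where
  open CommutativeRing R

  pow : Carrier → ℕ → Carrier
  pow x zero = 1#
  pow x (suc n) = x * pow x n

  fromℕ : ℕ → Carrier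
  fromℕ zero = 0#
  fromℕ (suc n) = 1# + fromℕ n

  sumR : List ℕ → (ℕ → Carrier) → Carrier
  sumR xs f = L.foldr (λ j acc → f j + acc) 0# xs

  NoZeroDivisors : Set (c Level.⊔ ℓ)
  NoZeroDivisors = ∀ x y → x * y ≈ 0# → x ≈ 0# ⊎ y ≈ 0#

  PrimitiveRoot : ℕ → Carrier → Set ℓ
  PrimitiveRoot k ζ = pow ζ k ≈ 1# × (∀ d → 0 < d → d < k → ¬ (pow ζ d ≈ 1#))
    where open import Data.Product using (_×_)

  -- Ramanujan sum c_k(j) = Σ_{1≤m≤k, gcd(m,k)=1} ζ^{m j}, ζ = primitive k-th root
  -- (for R = ℂ and ζ = exp(2πi/k) this is exactly the paper's definition)
  ramanujan : Carrier → ℕ → ℕ → Carrier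
  ramanujan ζ k j = sumR (filter (λ m → gcd m k N.≟ 1) (oneTo k)) (λ m → pow ζ (m N.* j))

mulR : {c ℓ : Level} (R : CommutativeRing c ℓ) → CommutativeRing.Carrier R → CommutativeRing.Carrier R → CommutativeRing.Carrier R
mulR R = CommutativeRing._*_ R

eqR : {c ℓ : Level} (R : CommutativeRing c ℓ) → CommutativeRing.Carrier R → CommutativeRing.Carrier R → Set ℓ
eqR R = CommutativeRing._≈_ R

{-# OPTIONS --safe #-}
-- If F n = Σ_{d ∣ n} h d, then F (gcd j k) = Σ_{d ∣ k, d ∣ j} h d, and swapping the sums leaves
-- Σ_{d ∣ k} h d Σ_{j ≤ k, d ∣ j} c_k(j).  Expanding c_k(j), each m coprime to k contributes to
-- the inner sum a geometric sum of powers of ζ^{m d}, a root of unity of order k / d: it vanishes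
-- unless d = k (here the absence of zero divisors is used), and then it is 1.  So the inner sum is
-- [d = k] φ k, whence Σ_j F (gcd j k) c_k(j) = h k φ k.  The three identities are the cases
-- h = φ (by Gauss, n = Σ_{d ∣ n} φ d), h = 1 and h = id.
module Submission where

open import Defs
open import Level using (Level)
open import Function using (_∘_)
open import Data.Nat using (ℕ; NonZero; zero; suc; _≤_; _<_; _≟_; s≤s)
import Data.Nat as N
import Data.Nat.Properties as NP
open import Data.Nat.Divisibility
  using (_∣_; divides; _∣?_; ∣-trans; ∣-antisym; ∣-refl; ∣⇒≤; n∣m*n; ∣m+n∣m⇒∣n; m%n≡0⇒n∣m; 0∣⇒≡0)
open import Data.Nat.DivMod using (_%_; _/_; m≡m%n+[m/n]*n; m%n<n)
open import Data.Nat.GCD using (gcd; gcd[m,n]∣m; gcd[m,n]∣n; gcd-greatest; gcd[m,n]≢0; c*gcd[m,n]≡gcd[cm,cn])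
open import Data.Nat.Coprimality using (coprime-divisor; gcd≡1⇒coprime)
import Data.Nat.Coprimality as Coprime
open import Data.Nat.ListAction using (sum)
open import Data.List using ([]; _∷_; _++_; [_]; filter; length; upTo)
import Data.List as L
open import Data.List.Properties using (upTo-∷ʳ; map-++)
open import Data.Product using (_×_; _,_; proj₁; proj₂)
open import Data.Sum using (inj₁; inj₂)
open import Relation.Nullary using (¬_; Dec; yes; no; contradiction)
open import Relation.Binary.PropositionalEquality as P using (_≡_; _≢_)
open import Algebra.Bundles using (CommutativeRing)

oneTo-suc : ∀ n → oneTo (suc n) ≡ oneTo n ++ [ suc n ]
oneTo-suc n = P.trans (P.cong (L.map suc) (P.sym (upTo-∷ʳ n))) (map-++ suc (upTo n) [ n ])

module _ {c ℓ : Level} (R : CommutativeRing c ℓ) where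
  open CommutativeRing R
  open import Relation.Binary.Reasoning.Setoid setoid
  open import Algebra.Properties.CommutativeSemigroup +-commutativeSemigroup using (interchange)
  open import Algebra.Properties.CommutativeSemigroup *-commutativeSemigroup using (x∙yz≈y∙xz; xy∙z≈y∙xz)
  open import Algebra.Properties.Ring ring using (-1*x≈-x)
  open import Algebra.Properties.Group +-group using (x∙y⁻¹≈ε⇒x≈y)
  open import Algebra.Properties.Semiring.Exp semiring using (_^_; ^-homo-*; ^-assocʳ; ^-congˡ)

  ⟦_⟧ : ∀ {p} {A : Set p} → Dec A → Carrier
  ⟦ yes _ ⟧ = 1#
  ⟦ no _ ⟧ = 0#

  ⟦⟧*-yes : ∀ {p} {A : Set p} (a? : Dec A) → A → ∀ x → ⟦ a? ⟧ * x ≈ x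
  ⟦⟧*-yes (yes _) _ x = *-identityˡ x
  ⟦⟧*-yes (no ¬a) a _ = contradiction a ¬a

  ⟦⟧*-no : ∀ {p} {A : Set p} (a? : Dec A) → ¬ A → ∀ x → ⟦ a? ⟧ * x ≈ 0#
  ⟦⟧*-no (yes a) ¬a _ = contradiction a ¬a
  ⟦⟧*-no (no _) _ x = zeroˡ x

  ⟦⟧*-guarded-cong : ∀ {p} {A : Set p} (a? : Dec A) {x y : Carrier} → (A → x ≈ y) → ⟦ a? ⟧ * x ≈ ⟦ a? ⟧ * y
  ⟦⟧*-guarded-cong (yes a) x≈y = *-congˡ (x≈y a)
  ⟦⟧*-guarded-cong (no _) _ = trans (zeroˡ _) (sym (zeroˡ _))

  ⟦⟧-cong : ∀ {p q} {A : Set p} {B : Set q} (a? : Dec A) (b? : Dec B) → (A → B) → (B → A) → ⟦ a? ⟧ ≈ ⟦ b? ⟧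
  ⟦⟧-cong (yes _) (yes _) _ _ = refl
  ⟦⟧-cong (no _) (no _) _ _ = refl
  ⟦⟧-cong (yes a) (no ¬b) a⇒b _ = contradiction (a⇒b a) ¬b
  ⟦⟧-cong (no ¬a) (yes b) _ b⇒a = contradiction (b⇒a b) ¬a

  ⟦⟧*⟦⟧-absorbˡ : ∀ {p q} {A : Set p} {B : Set q} (a? : Dec A) (b? : Dec B) → (B → A) → ⟦ a? ⟧ * ⟦ b? ⟧ ≈ ⟦ b? ⟧
  ⟦⟧*⟦⟧-absorbˡ (yes _) _ _ = *-identityˡ _
  ⟦⟧*⟦⟧-absorbˡ (no ¬a) b? b⇒a = trans (zeroˡ _) (sym (trans (sym (*-identityʳ _)) (⟦⟧*-no b? (¬a ∘ b⇒a) 1#)))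

  ∑ : ℕ → (ℕ → Carrier) → Carrier
  ∑ zero f = 0#
  ∑ (suc n) f = ∑ n f + f (suc n)

  ∑-cong-on : ∀ n {f g : ℕ → Carrier} → (∀ i → 1 ≤ i → i ≤ n → f i ≈ g i) → ∑ n f ≈ ∑ n g
  ∑-cong-on zero _ = refl
  ∑-cong-on (suc n) f≈g = +-cong (∑-cong-on n (λ i 1≤i i≤n → f≈g i 1≤i (NP.m≤n⇒m≤1+n i≤n))) (f≈g (suc n) (s≤s N.z≤n) NP.≤-refl)

  ∑-cong : ∀ n {f g : ℕ → Carrier} → (∀ i → f i ≈ g i) → ∑ n f ≈ ∑ n g
  ∑-cong n f≈g = ∑-cong-on n (λ i _ _ → f≈g i)

  ∑-zero : ∀ n {f : ℕ → Carrier} → (∀ i → 1 ≤ i → i ≤ n → f i ≈ 0#) → ∑ n f ≈ 0#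
  ∑-zero zero _ = refl
  ∑-zero (suc n) f≈0 = trans (+-cong (∑-zero n (λ i 1≤i i≤n → f≈0 i 1≤i (NP.m≤n⇒m≤1+n i≤n))) (f≈0 (suc n) (s≤s N.z≤n) NP.≤-refl)) (+-identityʳ 0#)

  ∑-distrib-+ : ∀ n (f g : ℕ → Carrier) → ∑ n (λ i → f i + g i) ≈ ∑ n f + ∑ n g
  ∑-distrib-+ zero _ _ = sym (+-identityʳ 0#)
  ∑-distrib-+ (suc n) f g = trans (+-congʳ (∑-distrib-+ n f g)) (interchange _ _ _ _)

  ∑-*ˡ : ∀ n a (f : ℕ → Carrier) → ∑ n (λ i → a * f i) ≈ a * ∑ n f
  ∑-*ˡ zero a _ = sym (zeroʳ a)
  ∑-*ˡ (suc n) a f = trans (+-congʳ (∑-*ˡ n a f)) (sym (distribˡ a _ _))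

  ∑-*ʳ : ∀ n a (f : ℕ → Carrier) → ∑ n (λ i → f i * a) ≈ ∑ n f * a
  ∑-*ʳ n a f = trans (∑-cong n (λ i → *-comm (f i) a)) (trans (∑-*ˡ n a f) (*-comm a _))

  ∑-comm : ∀ n m (f : ℕ → ℕ → Carrier) → ∑ n (λ i → ∑ m (f i)) ≈ ∑ m (λ j → ∑ n (λ i → f i j))
  ∑-comm zero m _ = sym (∑-zero m (λ _ _ _ → refl))
  ∑-comm (suc n) m f = trans (+-congʳ (∑-comm n m f)) (sym (∑-distrib-+ m _ _))

  ∑-split : ∀ a b (f : ℕ → Carrier) → ∑ (b N.+ a) f ≈ ∑ a f + ∑ b (λ i → f (i N.+ a))
  ∑-split a zero _ = sym (+-identityʳ _)
  ∑-split a (suc b) f = trans (+-congʳ (∑-split a b f)) (+-assoc _ _ _)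

  ∑-extend : ∀ n m (f : ℕ → Carrier) → n ≤ m → (∀ i → n < i → i ≤ m → f i ≈ 0#) → ∑ n f ≈ ∑ m f
  ∑-extend n zero _ N.z≤n _ = refl
  ∑-extend n (suc m) f n≤1+m f≈0 with NP.m≤n⇒m<n∨m≡n n≤1+m
  ... | inj₂ P.refl = refl
  ... | inj₁ n<1+m = begin
    ∑ n f               ≈⟨ ∑-extend n m f (NP.≤-pred n<1+m) (λ i n<i i≤m → f≈0 i n<i (NP.m≤n⇒m≤1+n i≤m)) ⟩
    ∑ m f               ≈⟨ +-identityʳ _ ⟨
    ∑ m f + 0#          ≈⟨ +-congˡ (f≈0 (suc m) n<1+m NP.≤-refl) ⟨
    ∑ m f + f (suc m)   ∎

  ∑-pick : ∀ n c (f : ℕ → Carrier) → 1 ≤ c → c ≤ n → ∑ n (λ i → ⟦ i ≟ c ⟧ * f i) ≈ f c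
  ∑-pick zero c _ 1≤c c≤0 = contradiction (NP.≤-trans 1≤c c≤0) λ ()
  ∑-pick (suc n) c f 1≤c c≤1+n with NP.m≤n⇒m<n∨m≡n c≤1+n
  ... | inj₁ c<1+n = trans (+-cong (∑-pick n c f 1≤c (NP.≤-pred c<1+n)) (⟦⟧*-no (suc n ≟ c) (NP.>⇒≢ c<1+n) _)) (+-identityʳ _)
  ... | inj₂ P.refl = trans (+-cong (∑-zero n (λ i _ i≤n → ⟦⟧*-no (i ≟ suc n) (NP.<⇒≢ (s≤s i≤n)) _)) (⟦⟧*-yes (suc n ≟ suc n) P.refl _)) (+-identityˡ _)

  ∑-1# : ∀ n → ∑ n (λ _ → 1#) ≈ fromℕ R n
  ∑-1# zero = refl
  ∑-1# (suc n) = trans (+-congʳ (∑-1# n)) (+-comm _ _)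

  ∤-inside-block : ∀ d q i → 0 < i → i < d → ¬ d ∣ i N.+ q N.* d
  ∤-inside-block d q i 0<i i<d d∣i+q*d = NP.<⇒≱ i<d (∣⇒≤ {{N.>-nonZero 0<i}} d∣i)
    where
    d∣i : d ∣ i
    d∣i = ∣m+n∣m⇒∣n (P.subst (d ∣_) (NP.+-comm i (q N.* d)) d∣i+q*d) (n∣m*n q)

  ∑-multiples : ∀ d .{{_ : NonZero d}} q (f : ℕ → Carrier) → ∑ (q N.* d) (λ j → ⟦ d ∣? j ⟧ * f j) ≈ ∑ q (λ t → f (t N.* d))
  ∑-multiples d zero _ = refl
  ∑-multiples d@(suc d-1) (suc q) f = begin
    ∑ (d N.+ q N.* d) g                              ≈⟨ ∑-split (q N.* d) d g ⟩
    ∑ (q N.* d) g + ∑ d (λ i → g (i N.+ q N.* d))     ≈⟨ +-cong (∑-multiples d q f) last-block ⟩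
    ∑ q (λ t → f (t N.* d)) + f (suc q N.* d)         ∎
    where
    g : ℕ → Carrier
    g j = ⟦ d ∣? j ⟧ * f j
    last-block : ∑ d (λ i → g (i N.+ q N.* d)) ≈ f (suc q N.* d)
    last-block = trans (+-cong (∑-zero d-1 (λ i 0<i i≤d-1 → ⟦⟧*-no (d ∣? _) (∤-inside-block d q i 0<i (s≤s i≤d-1)) _))
                               (⟦⟧*-yes (d ∣? _) (divides (suc q) P.refl) _))
                       (+-identityˡ _)

  sumR-++ : ∀ xs ys (f : ℕ → Carrier) → sumR R (xs ++ ys) f ≈ sumR R xs f + sumR R ys f
  sumR-++ [] _ _ = sym (+-identityˡ _)
  sumR-++ (x ∷ xs) ys f = trans (+-congˡ (sumR-++ xs ys f)) (sym (+-assoc _ _ _))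

  sumR-oneTo : ∀ n (f : ℕ → Carrier) → sumR R (oneTo n) f ≈ ∑ n f
  sumR-oneTo zero _ = refl
  sumR-oneTo (suc n) f = begin
    sumR R (oneTo (suc n)) f                   ≡⟨ P.cong (λ xs → sumR R xs f) (oneTo-suc n) ⟩
    sumR R (oneTo n ++ [ suc n ]) f            ≈⟨ sumR-++ (oneTo n) [ suc n ] f ⟩
    sumR R (oneTo n) f + (f (suc n) + 0#)      ≈⟨ +-cong (sumR-oneTo n f) (+-identityʳ _) ⟩
    ∑ n f + f (suc n)                          ∎

  sumR-filter : ∀ {p} {P : ℕ → Set p} (P? : ∀ i → Dec (P i)) xs (f : ℕ → Carrier) →
                sumR R (filter P? xs) f ≈ sumR R xs (λ i → ⟦ P? i ⟧ * f i)
  sumR-filter P? [] _ = refl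
  sumR-filter P? (x ∷ xs) f with P? x
  ... | yes _ = +-cong (sym (*-identityˡ _)) (sumR-filter P? xs f)
  ... | no _ = trans (sumR-filter P? xs f) (sym (trans (+-congʳ (zeroˡ _)) (+-identityˡ _)))

  sumR-filter-oneTo : ∀ {p} {P : ℕ → Set p} (P? : ∀ i → Dec (P i)) n (f : ℕ → Carrier) →
                      sumR R (filter P? (oneTo n)) f ≈ ∑ n (λ i → ⟦ P? i ⟧ * f i)
  sumR-filter-oneTo P? n f = trans (sumR-filter P? (oneTo n) f) (sumR-oneTo n _)

  fromℕ-+ : ∀ a b → fromℕ R (a N.+ b) ≈ fromℕ R a + fromℕ R b
  fromℕ-+ zero _ = sym (+-identityˡ _)
  fromℕ-+ (suc a) b = trans (+-congˡ (fromℕ-+ a b)) (sym (+-assoc _ _ _))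

  fromℕ-* : ∀ a b → fromℕ R (a N.* b) ≈ fromℕ R a * fromℕ R b
  fromℕ-* zero _ = sym (zeroˡ _)
  fromℕ-* (suc a) b = trans (fromℕ-+ b (a N.* b)) (trans (+-cong (sym (*-identityˡ _)) (fromℕ-* a b)) (sym (distribʳ _ _ _)))

  fromℕ-length : ∀ xs → fromℕ R (length xs) ≈ sumR R xs (λ _ → 1#)
  fromℕ-length [] = refl
  fromℕ-length (_ ∷ xs) = +-congˡ (fromℕ-length xs)

  fromℕ-sum : ∀ xs → fromℕ R (sum xs) ≈ sumR R xs (fromℕ R)
  fromℕ-sum [] = refl
  fromℕ-sum (x ∷ xs) = trans (fromℕ-+ x (sum xs)) (+-congˡ (fromℕ-sum xs))

  fromℕ-count : ∀ {p} {P : ℕ → Set p} (P? : ∀ i → Dec (P i)) n → fromℕ R (length (filter P? (oneTo n))) ≈ ∑ n (λ i → ⟦ P? i ⟧)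
  fromℕ-count P? n = trans (fromℕ-length (filter P? (oneTo n))) (trans (sumR-filter-oneTo P? n _) (∑-cong n (λ _ → *-identityʳ _)))

  pow≡^ : ∀ x n → pow R x n ≡ x ^ n
  pow≡^ _ zero = P.refl
  pow≡^ x (suc n) = P.cong (x *_) (pow≡^ x n)

  1#^n≈1# : ∀ n → 1# ^ n ≈ 1#
  1#^n≈1# zero = refl
  1#^n≈1# (suc n) = trans (*-identityˡ _) (1#^n≈1# n)

  ∑-geometric : ∀ q y → (y + - 1#) * ∑ q (y ^_) ≈ y ^ suc q + - y
  ∑-geometric zero y = trans (zeroʳ _) (sym (trans (+-congʳ (*-identityʳ y)) (-‿inverseʳ y)))
  ∑-geometric (suc q) y = begin
    (y + - 1#) * (∑ q (y ^_) + y ^ suc q)               ≈⟨ distribˡ _ _ _ ⟩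
    (y + - 1#) * ∑ q (y ^_) + (y + - 1#) * y ^ suc q    ≈⟨ +-congʳ (∑-geometric q y) ⟩
    (y ^ suc q + - y) + (y + - 1#) * y ^ suc q          ≈⟨ +-congˡ (trans (distribʳ _ y (- 1#)) (+-congˡ (-1*x≈-x _))) ⟩
    (y ^ suc q + - y) + (y * y ^ suc q + - y ^ suc q)   ≈⟨ regroup (y ^ suc q) (- y) (y * y ^ suc q) (- y ^ suc q) ⟩
    (y * y ^ suc q + - y) + (y ^ suc q + - y ^ suc q)   ≈⟨ +-congˡ (-‿inverseʳ _) ⟩
    (y * y ^ suc q + - y) + 0#                          ≈⟨ +-identityʳ _ ⟩
    y * y ^ suc q + - y                                 ∎
    where
    regroup : ∀ a b c d → (a + b) + (c + d) ≈ (c + b) + (a + d)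
    regroup a b c d = trans (interchange a b c d) (trans (+-congʳ (+-comm a c)) (sym (interchange c b a d)))

  ∑-root-of-unity : NoZeroDivisors R → ∀ q y → y ^ q ≈ 1# → ¬ y ≈ 1# → ∑ q (y ^_) ≈ 0#
  ∑-root-of-unity noZeroDivisors q y y^q≈1 y≉1 with noZeroDivisors (y + - 1#) (∑ q (y ^_)) product≈0
    where
    product≈0 : (y + - 1#) * ∑ q (y ^_) ≈ 0#
    product≈0 = trans (∑-geometric q y) (trans (+-congʳ (trans (*-congˡ y^q≈1) (*-identityʳ y))) (-‿inverseʳ y))
  ... | inj₁ y-1≈0 = contradiction (x∙y⁻¹≈ε⇒x≈y y 1# y-1≈0) y≉1
  ... | inj₂ sum≈0 = sum≈0

  ramanujan≈∑ : ∀ ζ k j → ramanujan R ζ k j ≈ ∑ k (λ m → ⟦ gcd m k ≟ 1 ⟧ * ζ ^ (m N.* j))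
  ramanujan≈∑ ζ k j = trans (sumR-filter-oneTo (λ m → gcd m k ≟ 1) k _) (∑-cong k (λ m → *-congˡ (reflexive (pow≡^ ζ (m N.* j)))))

  module _ (k : ℕ) .{{_ : NonZero k}} (ζ : Carrier) (prim : PrimitiveRoot R k ζ) where

    ζ^[m*k]≈1 : ∀ m → ζ ^ (m N.* k) ≈ 1#
    ζ^[m*k]≈1 m = begin
      ζ ^ (m N.* k)   ≡⟨ P.cong (ζ ^_) (NP.*-comm m k) ⟩
      ζ ^ (k N.* m)   ≈⟨ ^-assocʳ ζ k m ⟨
      (ζ ^ k) ^ m     ≈⟨ ^-congˡ m (trans (reflexive (P.sym (pow≡^ ζ k))) (proj₁ prim)) ⟩
      1# ^ m          ≈⟨ 1#^n≈1# m ⟩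
      1#              ∎

    ζ^n≈1⇒k∣n : ∀ n → ζ ^ n ≈ 1# → k ∣ n
    ζ^n≈1⇒k∣n n ζ^n≈1 with n % k ≟ 0
    ... | yes n%k≡0 = m%n≡0⇒n∣m n k n%k≡0
    ... | no n%k≢0 = contradiction ζ^[n%k]≈1 (proj₂ prim (n % k) (NP.n≢0⇒n>0 n%k≢0) (m%n<n n k))
      where
      ζ^[n%k]≈1 : pow R ζ (n % k) ≈ 1#
      ζ^[n%k]≈1 = begin
        pow R ζ (n % k)                     ≡⟨ pow≡^ ζ (n % k) ⟩
        ζ ^ (n % k)                         ≈⟨ *-identityʳ _ ⟨
        ζ ^ (n % k) * 1#                    ≈⟨ *-congˡ (ζ^[m*k]≈1 (n / k)) ⟨
        ζ ^ (n % k) * ζ ^ (n / k N.* k)     ≈⟨ ^-homo-* ζ (n % k) _ ⟨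
        ζ ^ (n % k N.+ n / k N.* k)         ≡⟨ P.cong (ζ ^_) (m≡m%n+[m/n]*n n k) ⟨
        ζ ^ n                               ≈⟨ ζ^n≈1 ⟩
        1#                                  ∎

    ∑-multiples-ζ^[m*j] : NoZeroDivisors R → ∀ d m → d ∣ k → gcd m k ≡ 1 →
                          ∑ k (λ j → ⟦ d ∣? j ⟧ * ζ ^ (m N.* j)) ≈ ⟦ d ≟ k ⟧
    ∑-multiples-ζ^[m*j] _ zero _ 0∣k _ = contradiction (0∣⇒≡0 0∣k) (N.≢-nonZero⁻¹ k)
    ∑-multiples-ζ^[m*j] noZeroDivisors d@(suc _) m (divides q k≡q*d) gcd[m,k]≡1 = begin
      ∑ k f                              ≡⟨ P.cong (λ n → ∑ n f) k≡q*d ⟩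
      ∑ (q N.* d) f                      ≈⟨ ∑-multiples d q _ ⟩
      ∑ q (λ t → ζ ^ (m N.* (t N.* d)))  ≈⟨ ∑-cong q ζ^[m*t*d]≈y^t ⟩
      ∑ q (y ^_)                         ≈⟨ geometric (d ≟ k) ⟩
      ⟦ d ≟ k ⟧                          ∎
      where
      f : ℕ → Carrier
      f j = ⟦ d ∣? j ⟧ * ζ ^ (m N.* j)
      y : Carrier
      y = ζ ^ (m N.* d)
      m*[t*d]≡m*d*t : ∀ t → m N.* (t N.* d) ≡ m N.* d N.* t
      m*[t*d]≡m*d*t t = P.trans (P.cong (m N.*_) (NP.*-comm t d)) (P.sym (NP.*-assoc m d t))
      ζ^[m*t*d]≈y^t : ∀ t → ζ ^ (m N.* (t N.* d)) ≈ y ^ t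
      ζ^[m*t*d]≈y^t t = trans (reflexive (P.cong (ζ ^_) (m*[t*d]≡m*d*t t))) (sym (^-assocʳ ζ (m N.* d) t))
      y^q≈1 : y ^ q ≈ 1#
      y^q≈1 = trans (sym (ζ^[m*t*d]≈y^t q))
                    (trans (reflexive (P.cong (λ n → ζ ^ (m N.* n)) (P.sym k≡q*d)))
                           (ζ^[m*k]≈1 m))
      geometric : (d≟k : Dec (d ≡ k)) → ∑ q (y ^_) ≈ ⟦ d≟k ⟧
      geometric (yes d≡k) = begin
        ∑ q (y ^_)   ≡⟨ P.cong (λ n → ∑ n (y ^_)) q≡1 ⟩
        ∑ 1 (y ^_)   ≈⟨ +-identityˡ _ ⟩
        y ^ 1        ≡⟨ P.cong (y ^_) q≡1 ⟨
        y ^ q        ≈⟨ y^q≈1 ⟩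
        1#           ∎
        where
        q≡1 : q ≡ 1
        q≡1 = NP.*-cancelʳ-≡ q 1 k (P.trans (P.cong (q N.*_) (P.sym d≡k)) (P.trans (P.sym k≡q*d) (P.sym (NP.*-identityˡ k))))
      geometric (no d≢k) = ∑-root-of-unity noZeroDivisors q y y^q≈1 (λ y≈1 → d≢k (∣-antisym (divides q k≡q*d) (k∣d y≈1)))
        where
        k∣d : y ≈ 1# → k ∣ d
        k∣d y≈1 = coprime-divisor (Coprime.sym (gcd≡1⇒coprime {m} {k} gcd[m,k]≡1)) (ζ^n≈1⇒k∣n (m N.* d) y≈1)

    ∑-multiples-ramanujan : NoZeroDivisors R → ∀ d → d ∣ k →
                            ∑ k (λ j → ⟦ d ∣? j ⟧ * ramanujan R ζ k j) ≈ ⟦ d ≟ k ⟧ * fromℕ R (φ k)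
    ∑-multiples-ramanujan noZeroDivisors d d∣k = begin
      ∑ k (λ j → ⟦ d ∣? j ⟧ * ramanujan R ζ k j)
        ≈⟨ ∑-cong k (λ j → *-congˡ (ramanujan≈∑ ζ k j)) ⟩
      ∑ k (λ j → ⟦ d ∣? j ⟧ * ∑ k (λ m → ⟦ coprime? m ⟧ * ζ ^ (m N.* j)))
        ≈⟨ ∑-cong k (λ j → trans (sym (∑-*ˡ k _ _)) (∑-cong k (λ m → x∙yz≈y∙xz _ _ _))) ⟩
      ∑ k (λ j → ∑ k (λ m → ⟦ coprime? m ⟧ * (⟦ d ∣? j ⟧ * ζ ^ (m N.* j))))
        ≈⟨ ∑-comm k k _ ⟩
      ∑ k (λ m → ∑ k (λ j → ⟦ coprime? m ⟧ * (⟦ d ∣? j ⟧ * ζ ^ (m N.* j))))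
        ≈⟨ ∑-cong k (λ m → ∑-*ˡ k _ _) ⟩
      ∑ k (λ m → ⟦ coprime? m ⟧ * ∑ k (λ j → ⟦ d ∣? j ⟧ * ζ ^ (m N.* j)))
        ≈⟨ ∑-cong k (λ m → ⟦⟧*-guarded-cong (coprime? m) (∑-multiples-ζ^[m*j] noZeroDivisors d m d∣k)) ⟩
      ∑ k (λ m → ⟦ coprime? m ⟧ * ⟦ d ≟ k ⟧)
        ≈⟨ ∑-*ʳ k _ _ ⟩
      ∑ k (λ m → ⟦ coprime? m ⟧) * ⟦ d ≟ k ⟧
        ≈⟨ *-comm _ _ ⟩
      ⟦ d ≟ k ⟧ * ∑ k (λ m → ⟦ coprime? m ⟧)
        ≈⟨ *-congˡ (fromℕ-count coprime? k) ⟨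
      ⟦ d ≟ k ⟧ * fromℕ R (φ k)          ∎
      where
      coprime? : ∀ m → Dec (gcd m k ≡ 1)
      coprime? m = gcd m k ≟ 1

  divisorSum : (ℕ → Carrier) → ℕ → Carrier
  divisorSum h n = ∑ n (λ d → ⟦ d ∣? n ⟧ * h d)

  divisorSum-gcd : ∀ (h : ℕ → Carrier) k .{{_ : NonZero k}} j → divisorSum h (gcd j k) ≈ ∑ k (λ d → ⟦ d ∣? k ⟧ * (⟦ d ∣? j ⟧ * h d))
  divisorSum-gcd h k j = trans (∑-extend g k _ g≤k beyond-g) (∑-cong k bracket-gcd)
    where
    g : ℕ
    g = gcd j k
    instance
      g≢0 : NonZero g
      g≢0 = N.≢-nonZero (gcd[m,n]≢0 j k (inj₂ (N.≢-nonZero⁻¹ k)))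
    g≤k : g ≤ k
    g≤k = ∣⇒≤ (gcd[m,n]∣n j k)
    beyond-g : ∀ i → g < i → i ≤ k → ⟦ i ∣? g ⟧ * h i ≈ 0#
    beyond-g i g<i _ = ⟦⟧*-no (i ∣? g) (λ i∣g → NP.<⇒≱ g<i (∣⇒≤ i∣g)) _
    bracket-gcd : ∀ d → ⟦ d ∣? g ⟧ * h d ≈ ⟦ d ∣? k ⟧ * (⟦ d ∣? j ⟧ * h d)
    bracket-gcd d with d ∣? j | d ∣? k
    ... | yes d∣j | yes d∣k = trans (⟦⟧*-yes (d ∣? g) (gcd-greatest d∣j d∣k) _) (sym (trans (*-identityˡ _) (*-identityˡ _)))
    ... | no d∤j | _ = trans (⟦⟧*-no (d ∣? g) (λ d∣g → d∤j (∣-trans d∣g (gcd[m,n]∣m j k))) _) (sym (trans (*-congˡ (zeroˡ _)) (zeroʳ _)))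
    ... | yes _ | no d∤k = trans (⟦⟧*-no (d ∣? g) (λ d∣g → d∤k (∣-trans d∣g (gcd[m,n]∣n j k))) _) (sym (zeroˡ _))

  τ≈divisorSum-1 : ∀ n → fromℕ R (τ n) ≈ divisorSum (λ _ → 1#) n
  τ≈divisorSum-1 n = trans (fromℕ-count (_∣? n) n) (∑-cong n (λ _ → sym (*-identityʳ _)))

  σ≈divisorSum-id : ∀ n → fromℕ R (σ n) ≈ divisorSum (fromℕ R) n
  σ≈divisorSum-id n = trans (fromℕ-sum (divisors n)) (sumR-filter-oneTo (_∣? n) n _)

  -- The m ≤ n with gcd(m, n) = n / d are the multiples t (n / d) with t ≤ d coprime to d.
  φ≈∑-gcd-cofactor : ∀ n .{{_ : NonZero n}} d → d ∣ n → fromℕ R (φ d) ≈ ∑ n (λ m → ⟦ gcd m n N.* d ≟ n ⟧)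
  φ≈∑-gcd-cofactor n d (divides zero n≡0) = contradiction n≡0 (N.≢-nonZero⁻¹ n)
  φ≈∑-gcd-cofactor n d (divides q@(suc _) n≡q*d) = sym (begin
    ∑ n (λ m → ⟦ cofactor? m ⟧)                   ≈⟨ ∑-cong n (λ m → ⟦⟧*⟦⟧-absorbˡ (q ∣? m) (cofactor? m) (q∣m m)) ⟨
    ∑ n (λ m → ⟦ q ∣? m ⟧ * ⟦ cofactor? m ⟧)      ≡⟨ P.cong (λ n′ → ∑ n′ (λ m → ⟦ q ∣? m ⟧ * ⟦ cofactor? m ⟧)) (P.trans n≡q*d (NP.*-comm q d)) ⟩
    ∑ (d N.* q) (λ m → ⟦ q ∣? m ⟧ * ⟦ cofactor? m ⟧) ≈⟨ ∑-multiples q d _ ⟩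
    ∑ d (λ t → ⟦ cofactor? (t N.* q) ⟧)           ≈⟨ ∑-cong d (λ t → ⟦⟧-cong (cofactor? (t N.* q)) (gcd t d ≟ 1) (coprime t) (multiple t)) ⟩
    ∑ d (λ t → ⟦ gcd t d ≟ 1 ⟧)                   ≈⟨ fromℕ-count (λ t → gcd t d ≟ 1) d ⟨
    fromℕ R (φ d)                                 ∎)
    where
    cofactor? : ∀ m → Dec (gcd m n N.* d ≡ n)
    cofactor? m = gcd m n N.* d ≟ n
    instance
      d≢0 : NonZero d
      d≢0 = N.≢-nonZero λ { P.refl → N.≢-nonZero⁻¹ n (P.trans n≡q*d (NP.*-zeroʳ q)) }
    gcd≡q : ∀ m → gcd m n N.* d ≡ n → gcd m n ≡ q
    gcd≡q m e = NP.*-cancelʳ-≡ (gcd m n) q d (P.trans e n≡q*d)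
    q∣m : ∀ m → gcd m n N.* d ≡ n → q ∣ m
    q∣m m e = P.subst (_∣ m) (gcd≡q m e) (gcd[m,n]∣m m n)
    gcd[t*q,n]≡q*gcd[t,d] : ∀ t → gcd (t N.* q) n ≡ q N.* gcd t d
    gcd[t*q,n]≡q*gcd[t,d] t = P.trans (P.cong₂ gcd (NP.*-comm t q) n≡q*d) (P.sym (c*gcd[m,n]≡gcd[cm,cn] q t d))
    coprime : ∀ t → gcd (t N.* q) n N.* d ≡ n → gcd t d ≡ 1
    coprime t e = NP.*-cancelˡ-≡ (gcd t d) 1 q (P.trans (P.sym (gcd[t*q,n]≡q*gcd[t,d] t))
                                                        (P.trans (gcd≡q (t N.* q) e) (P.sym (NP.*-identityʳ q))))
    multiple : ∀ t → gcd t d ≡ 1 → gcd (t N.* q) n N.* d ≡ n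
    multiple t e = P.trans (P.cong (N._* d) (P.trans (gcd[t*q,n]≡q*gcd[t,d] t) (P.trans (P.cong (q N.*_) e) (NP.*-identityʳ q))))
                           (P.sym n≡q*d)

  ∑-unique-cofactor : ∀ n .{{_ : NonZero n}} g → g ∣ n → ∑ n (λ d → ⟦ d ∣? n ⟧ * ⟦ g N.* d ≟ n ⟧) ≈ 1#
  ∑-unique-cofactor n g (divides c n≡c*g) = begin
    ∑ n (λ d → ⟦ d ∣? n ⟧ * ⟦ g N.* d ≟ n ⟧)   ≈⟨ ∑-cong n (λ d → ⟦⟧*⟦⟧-absorbˡ (d ∣? n) (g N.* d ≟ n) (λ e → divides g (P.sym e))) ⟩
    ∑ n (λ d → ⟦ g N.* d ≟ n ⟧)               ≈⟨ ∑-cong n (λ d → trans (⟦⟧-cong (g N.* d ≟ n) (d ≟ c) (d≡c d) (λ d≡c → g*d≡n d≡c)) (sym (*-identityʳ _))) ⟩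
    ∑ n (λ d → ⟦ d ≟ c ⟧ * 1#)                ≈⟨ ∑-pick n c (λ _ → 1#) (NP.n≢0⇒n>0 c≢0) c≤n ⟩
    1#                                        ∎
    where
    n≡g*c : n ≡ g N.* c
    n≡g*c = P.trans n≡c*g (NP.*-comm c g)
    d≡c : ∀ d → g N.* d ≡ n → d ≡ c
    d≡c d e = NP.*-cancelˡ-≡ d c g {{N.≢-nonZero λ { P.refl → N.≢-nonZero⁻¹ n n≡g*c }}} (P.trans e n≡g*c)
    g*d≡n : ∀ {d} → d ≡ c → g N.* d ≡ n
    g*d≡n P.refl = P.sym n≡g*c
    c≢0 : c ≢ 0
    c≢0 P.refl = N.≢-nonZero⁻¹ n n≡c*g
    c≤n : c ≤ n
    c≤n = ∣⇒≤ (divides g n≡g*c)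

  id≈divisorSum-φ : ∀ n → fromℕ R n ≈ divisorSum (fromℕ R ∘ φ) n
  id≈divisorSum-φ zero = refl
  id≈divisorSum-φ n@(suc _) = sym (begin
    ∑ n (λ d → ⟦ d ∣? n ⟧ * fromℕ R (φ d))
      ≈⟨ ∑-cong n (λ d → ⟦⟧*-guarded-cong (d ∣? n) (φ≈∑-gcd-cofactor n d)) ⟩
    ∑ n (λ d → ⟦ d ∣? n ⟧ * ∑ n (λ m → ⟦ gcd m n N.* d ≟ n ⟧))
      ≈⟨ ∑-cong n (λ d → ∑-*ˡ n _ _) ⟨
    ∑ n (λ d → ∑ n (λ m → ⟦ d ∣? n ⟧ * ⟦ gcd m n N.* d ≟ n ⟧))
      ≈⟨ ∑-comm n n _ ⟩
    ∑ n (λ m → ∑ n (λ d → ⟦ d ∣? n ⟧ * ⟦ gcd m n N.* d ≟ n ⟧))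
      ≈⟨ ∑-cong n (λ m → ∑-unique-cofactor n (gcd m n) (gcd[m,n]∣n m n)) ⟩
    ∑ n (λ _ → 1#)
      ≈⟨ ∑-1# n ⟩
    fromℕ R n ∎)

  ∑-divisorSum-gcd*ramanujan : NoZeroDivisors R → ∀ k .{{_ : NonZero k}} ζ → PrimitiveRoot R k ζ →
    ∀ (F h : ℕ → Carrier) → (∀ n → F n ≈ divisorSum h n) →
    sumR R (oneTo k) (λ j → F (gcd j k) * ramanujan R ζ k j) ≈ h k * fromℕ R (φ k)
  ∑-divisorSum-gcd*ramanujan noZeroDivisors k ζ prim F h F≈divisorSum-h = begin
    sumR R (oneTo k) (λ j → F (gcd j k) * cₖ j)
      ≈⟨ sumR-oneTo k _ ⟩
    ∑ k (λ j → F (gcd j k) * cₖ j)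
      ≈⟨ ∑-cong k (λ j → *-congʳ (trans (F≈divisorSum-h (gcd j k)) (divisorSum-gcd h k j))) ⟩
    ∑ k (λ j → ∑ k (λ d → ⟦ d ∣? k ⟧ * (⟦ d ∣? j ⟧ * h d)) * cₖ j)
      ≈⟨ ∑-cong k (λ j → trans (sym (∑-*ʳ k _ _)) (∑-cong k (λ d → rearrange _ _ _ _))) ⟩
    ∑ k (λ j → ∑ k (λ d → ⟦ d ∣? k ⟧ * (h d * (⟦ d ∣? j ⟧ * cₖ j))))
      ≈⟨ ∑-comm k k _ ⟩
    ∑ k (λ d → ∑ k (λ j → ⟦ d ∣? k ⟧ * (h d * (⟦ d ∣? j ⟧ * cₖ j))))
      ≈⟨ ∑-cong k (λ d → trans (∑-*ˡ k _ _) (*-congˡ (∑-*ˡ k _ _))) ⟩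
    ∑ k (λ d → ⟦ d ∣? k ⟧ * (h d * ∑ k (λ j → ⟦ d ∣? j ⟧ * cₖ j)))
      ≈⟨ ∑-cong k (λ d → ⟦⟧*-guarded-cong (d ∣? k) (λ d∣k → *-congˡ (∑-multiples-ramanujan k ζ prim noZeroDivisors d d∣k))) ⟩
    ∑ k (λ d → ⟦ d ∣? k ⟧ * (h d * (⟦ d ≟ k ⟧ * Φ)))
      ≈⟨ ∑-cong k only-k ⟩
    ∑ k (λ d → ⟦ d ≟ k ⟧ * (h d * Φ))
      ≈⟨ ∑-pick k k (λ d → h d * Φ) (NP.n≢0⇒n>0 (N.≢-nonZero⁻¹ k)) NP.≤-refl ⟩
    h k * Φ ∎
    where
    cₖ : ℕ → Carrier
    cₖ = ramanujan R ζ k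
    Φ : Carrier
    Φ = fromℕ R (φ k)
    rearrange : ∀ a b x e → (a * (b * x)) * e ≈ a * (x * (b * e))
    rearrange a b x e = trans (*-assoc a _ e) (*-congˡ (xy∙z≈y∙xz b x e))
    only-k : ∀ d → ⟦ d ∣? k ⟧ * (h d * (⟦ d ≟ k ⟧ * Φ)) ≈ ⟦ d ≟ k ⟧ * (h d * Φ)
    only-k d with d ≟ k
    ... | yes P.refl = trans (⟦⟧*-yes (d ∣? d) ∣-refl _) (trans (*-congˡ (*-identityˡ _)) (sym (*-identityˡ _)))
    ... | no _ = trans (*-congˡ (trans (*-congˡ (zeroˡ _)) (zeroʳ _))) (trans (zeroʳ _) (sym (zeroˡ _)))

corollary1 : {c ℓ : Level} (R : CommutativeRing c ℓ) → NoZeroDivisors R →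
    (k : ℕ) → .{{_ : NonZero k}} → (ζ : CommutativeRing.Carrier R) → PrimitiveRoot R k ζ →
    eqR R (sumR R (oneTo k) (λ j → mulR R (fromℕ R (gcd j k)) (ramanujan R ζ k j))) (fromℕ R (φ k N.* φ k))
    × eqR R (sumR R (oneTo k) (λ j → mulR R (fromℕ R (τ (gcd j k))) (ramanujan R ζ k j))) (fromℕ R (φ k))
    × eqR R (sumR R (oneTo k) (λ j → mulR R (fromℕ R (σ (gcd j k))) (ramanujan R ζ k j))) (fromℕ R (k N.* φ k))
corollary1 R noZeroDivisors k ζ prim =
    trans (∑-F[gcd] (fromℕ R) (fromℕ R ∘ φ) (id≈divisorSum-φ R)) (sym (fromℕ-* R (φ k) (φ k)))
  , trans (∑-F[gcd] (fromℕ R ∘ τ) (λ _ → 1#) (τ≈divisorSum-1 R)) (*-identityˡ _)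
  , trans (∑-F[gcd] (fromℕ R ∘ σ) (fromℕ R) (σ≈divisorSum-id R)) (sym (fromℕ-* R k (φ k)))
  where
  open CommutativeRing R using (Carrier; _≈_; _*_; trans; sym; *-identityˡ; 1#)
  ∑-F[gcd] : ∀ (F h : ℕ → Carrier) → (∀ n → F n ≈ divisorSum R h n) →
             sumR R (oneTo k) (λ j → F (gcd j k) * ramanujan R ζ k j) ≈ h k * fromℕ R (φ k)
  ∑-F[gcd] = ∑-divisorSum-gcd*ramanujan R noZeroDivisors k ζ prim
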